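{- Let $G$ be a finite simple graph with a vertex $u$ and $H$ a finite simple graph with a vertex $w$. Let $G'$ be the graph obtained from the disjoint union of $G$ and $H$ by identifying $u$ and $w$. Then $p(G';z)=p(G;z)\,p(H;z)-p_u(G;z)\,p_w(H;z)$.
   Context: A perfectly matchable set of a graph $G$ is a subset $S\subseteq V(G)$ such that $G[S]$ has a perfect matching (the empty set included). $p(G;z)=\sum_{k\ge0}p_{2k}z^k$, where $p_{2k}$ is the number of perfectly matchable sets of size $2k$. For a vertex $v$, $p_v(G;z)=p(G;z)-p(G-v;z)$, the generating function (by half-size) of perfectly matchable sets containing $v$. -}

module Defs where

open import Data.Bool using (Bool; true; false; _∧_; _∨_; not; if_then_else_)
open import Data.Nat using (ℕ; zero; suc; _+_; _∸_; _≡ᵇ_)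
open import Data.Integer using (ℤ; +_; _-_) renaming (_+_ to _+ℤ_; _*_ to _*ℤ_)
open import Data.Fin using (Fin; zero; suc; punchIn; splitAt; _≟_)
open import Data.Vec using (Vec; []; _∷_; lookup)
open import Data.List using (List; []; _∷_; map; concatMap; allFin; filterᵇ; length)
open import Data.Bool.ListAction using (any; all)
open import Data.Sum using (inj₁; inj₂)
open import Relation.Nullary using (does)
open import Relation.Binary.PropositionalEquality using (_≡_)

Adj : ℕ → Set
Adj n = Fin n → Fin n → Bool

record IsSimple {n : ℕ} (adj : Adj n) : Set where
  field
    symmetric   : ∀ i j → adj i j ≡ adj j i
    irreflexive : ∀ i → adj i i ≡ false

Subset : ℕ → Set
Subset n = Vec Bool n

allVecs : {A : Set} → List A → (n : ℕ) → List (Vec A n)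
allVecs xs zero    = [] ∷ []
allVecs xs (suc n) = concatMap (λ x → map (x ∷_) (allVecs xs n)) xs

allSubsets : (n : ℕ) → List (Subset n)
allSubsets n = allVecs (true ∷ false ∷ []) n

size : {n : ℕ} → Subset n → ℕ
size []          = 0
size (true ∷ s)  = suc (size s)
size (false ∷ s) = size s

_==_ : {n : ℕ} → Fin n → Fin n → Bool
i == j = does (i ≟ j)

-- f (a map Fin n → Fin n, as a vector) is a perfect matching of G[S]:
-- on S it is a fixed-point-free involution of S pairing adjacent vertices.
isPerfectMatching : {n : ℕ} → Adj n → Subset n → Vec (Fin n) n → Bool
isPerfectMatching {n} adj S f =
  all (λ v → not (lookup S v) ∨
             (lookup S (lookup f v) ∧ not (lookup f v == v) ∧
              adj v (lookup f v) ∧ (lookup f (lookup f v) == v)))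
      (allFin n)

perfectlyMatchable : {n : ℕ} → Adj n → Subset n → Bool
perfectlyMatchable {n} adj S =
  any (isPerfectMatching adj S) (allVecs (allFin n) n)

Poly : Set
Poly = ℕ → ℤ

-- p(G;z): coefficient of z^k is the number of perfectly matchable sets of size 2k.
p : {n : ℕ} → Adj n → Poly
p {n} adj k = + length (filterᵇ (λ S → perfectlyMatchable adj S ∧ (size S ≡ᵇ (k + k)))
                                (allSubsets n))

deleteVertex : {n : ℕ} → Adj (suc n) → Fin (suc n) → Adj n
deleteVertex adj v i j = adj (punchIn v i) (punchIn v j)

pv : {n : ℕ} → Adj (suc n) → Fin (suc n) → Poly
pv adj v k = p adj k - p (deleteVertex adj v) k

sumUpTo : ℕ → (ℕ → ℤ) → ℤ
sumUpTo zero    f = f 0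
sumUpTo (suc k) f = sumUpTo k f +ℤ f (suc k)

_*ₚ_ : Poly → Poly → Poly
(f *ₚ g) k = sumUpTo k (λ i → f i *ℤ g (k ∸ i))

_-ₚ_ : Poly → Poly → Poly
(f -ₚ g) k = f k - g k

-- G' has vertex set Fin (suc n + m): the first suc n vertices are those of G
-- (u playing the role of the identified vertex), the remaining m vertices
-- (indexed by j : Fin m) are the vertices punchIn w j of H other than w.
glue : {n m : ℕ} → Adj (suc n) → Fin (suc n) → Adj (suc m) → Fin (suc m) → Adj (suc n + m)
glue {n} {m} G u H w x y with splitAt (suc n) x | splitAt (suc n) y
... | inj₁ a | inj₁ b = G a b
... | inj₂ i | inj₂ j = H (punchIn w i) (punchIn w j)
... | inj₁ a | inj₂ j = if a == u then H w (punchIn w j) else false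
... | inj₂ i | inj₁ b = if b == u then H (punchIn w i) w else false

{-# OPTIONS --safe #-}
-- A perfect matching of a vertex set S of G′ pairs the glued vertex with a partner either
-- in G or in H. In the first case the pairs split into a perfect matching of S ∩ G in G and
-- one of S ∩ (H − w) in H; in the second, of S ∩ (G − u) in G and of S ∩ H in H. When
-- u ∈ S these cases exclude each other, since S ∩ G and S ∩ (G − u) differ in size by one
-- and matchable sets are even. So with c(G) = p_u(G) and a(G) = p(G − u) the counts of
-- matchable sets containing, resp. avoiding, u:
--   p(G′) = c(G) a(H) + a(G) c(H) + a(G) a(H) = (c(G) + a(G)) (c(H) + a(H)) − c(G) c(H).
module Submission where

open import Defs
open import Data.Bool using (Bool; true; false; T; not; _∧_; _∨_; if_then_else_)
open import Data.Bool.Properties using (T-∧; T-∨; T-≡; ⇔→≡; ∧-identityʳ; ∧-zeroʳ; ∧-assoc; ∨-identityʳ; ∨-idem)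
open import Data.Fin using (Fin; zero; suc; _≟_; punchIn; punchOut; splitAt; _↑ˡ_; _↑ʳ_)
open import Data.Fin.Properties
  using (punchInᵢ≢i; punchIn-punchOut; punchOut-punchIn; punchOut-cong;
         splitAt-↑ˡ; splitAt-↑ʳ; splitAt⁻¹-↑ˡ; splitAt⁻¹-↑ʳ)
open import Data.Integer using (ℤ; +_; _-_) renaming (_+_ to _+ℤ_; _*_ to _*ℤ_)
open import Data.Integer.Properties using (pos-+; pos-*)
import Data.Integer.Tactic.RingSolver as ℤ-Solver
open import Data.List using (List; []; _∷_; map; allFin; filterᵇ; length) renaming (_++_ to _++ᴸ_)
open import Data.List.Membership.Propositional using (_∈_; lose)
open import Data.List.Membership.Propositional.Properties using (∈-allFin; ∈-map⁺; ∈-concatMap⁺)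
open import Data.List.Properties using (map-++; map-∘; ++-identityʳ)
open import Data.List.Relation.Unary.All as All using (All)
open import Data.List.Relation.Unary.All.Properties using (all⁺; all⁻)
open import Data.List.Relation.Unary.Any as Any using (Any)
open import Data.List.Relation.Unary.Any.Properties using (any⁺; any⁻)
open import Data.Maybe using (Maybe; just; nothing; maybe′)
open import Data.Maybe.Properties using (just-injective)
open import Data.Nat using (ℕ; zero; suc; _+_; _*_; _∸_; _≡ᵇ_; _≤_; _<_; _≤?_; s≤s)
open import Data.Nat.ListAction using (sum)
open import Data.Nat.ListAction.Properties using (sum-++)
import Data.Nat.Properties as ℕ
open import Data.Nat.Properties
  using (suc-injective; +-suc; +-identityʳ; +-comm; *-distribʳ-+; ≡ᵇ⇒≡; ≡⇒≡ᵇ; <⇒≢; >⇒≢; +-mono-<; <-trans; <-≤-trans;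
         n<1+n; ≤-refl; ≤-antisym; ≰⇒>; +-cancelˡ-≡; m+[n∸m]≡n; m≤m+n; +-commutativeSemigroup)
open import Data.Nat.Tactic.RingSolver using (solve-∀)
open import Algebra.Properties.CommutativeSemigroup +-commutativeSemigroup using (interchange)
open import Data.Product using (∃; _×_; _,_; proj₁; proj₂; uncurry)
open import Data.Product.Function.NonDependent.Propositional using (_×-⇔_)
open import Data.Sum using (_⊎_; inj₁; inj₂; [_,_]′)
open import Data.Sum.Function.Propositional using (_⊎-⇔_)
open import Data.Unit using (tt)
open import Data.Vec using (Vec; []; _∷_; lookup; tabulate; insertAt; _++_; _[_]≔_)
open import Data.Vec.Properties
  using (lookup∘tabulate; lookup∘update; lookup∘update′; insertAt-punchIn; insertAt-lookup; lookup-++ˡ; lookup-++ʳ)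
open import Function using (_∘_; const; _⇔_; mk⇔; Equivalence)
open import Function.Properties.Equivalence using () renaming (trans to ⇔-trans; sym to ⇔-sym)
open import Relation.Binary.PropositionalEquality
open import Relation.Nullary using (¬_; yes; no; contradiction)
open import Relation.Nullary.Decidable using (T?; dec-true; dec-false)

private
  variable
    n : ℕ

T-== : {i j : Fin n} → T (i == j) ⇔ i ≡ j
T-== {i = i} {j} with i ≟ j
... | yes i≡j = mk⇔ (const i≡j) (const tt)
... | no i≢j = mk⇔ (λ ()) i≢j

T-==-refl : (i : Fin n) → T (i == i)
T-==-refl i = Equivalence.from (T-== {i = i}) refl

T-not : ∀ {b} → T (not b) ⇔ (¬ T b)
T-not {false} = mk⇔ (const λ ()) (const tt)
T-not {true}  = mk⇔ (λ ()) (λ ¬t → ¬t tt)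

if-T : ∀ {A : Set} {b} {x y : A} → T b → (if b then x else y) ≡ x
if-T {b = true} _ = refl

if-¬T : ∀ {A : Set} {b} {x y : A} → ¬ T b → (if b then x else y) ≡ y
if-¬T {b = false} _ = refl
if-¬T {b = true}  ¬t = contradiction tt ¬t

T-⇔⇒≡ : ∀ {x y} → (T x ⇔ T y) → x ≡ y
T-⇔⇒≡ x⇔y = ⇔→≡ {z = true} (⇔-trans (⇔-sym T-≡) (⇔-trans x⇔y T-≡))

-- Perfect matchings as fixpoint-free involutions

record IsMatching (adj : Adj n) (S : Fin n → Bool) (f : Fin n → Fin n) : Set where
  field
    closed       : ∀ {v} → T (S v) → T (S (f v))
    fixpointFree : ∀ {v} → T (S v) → f v ≢ v
    adjacent     : ∀ {v} → T (S v) → T (adj v (f v))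
    involutive   : ∀ {v} → T (S v) → f (f v) ≡ v

Matchable : Adj n → (Fin n → Bool) → Set
Matchable adj S = ∃ (IsMatching adj S)

module _ {adj : Adj n} where

  IsMatching-≗ : ∀ {S f g} → f ≗ g → IsMatching adj S f → IsMatching adj S g
  IsMatching-≗ {S = S} {f} {g} f≗g m = record
    { closed       = λ v∈S → subst (T ∘ S) (f≗g _) (closed v∈S)
    ; fixpointFree = λ v∈S gv≡v → fixpointFree v∈S (trans (f≗g _) gv≡v)
    ; adjacent     = λ v∈S → subst (T ∘ adj _) (f≗g _) (adjacent v∈S)
    ; involutive   = λ {v} v∈S → trans (sym (trans (f≗g (f v)) (cong g (f≗g v)))) (involutive v∈S)
    }
    where open IsMatching m

  Matchable-≗ : ∀ {S S′} → S ≗ S′ → Matchable adj S ⇔ Matchable adj S′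
  Matchable-≗ S≗S′ = mk⇔ (transfer S≗S′) (transfer (sym ∘ S≗S′))
    where
    transfer : ∀ {S S′} → S ≗ S′ → Matchable adj S → Matchable adj S′
    transfer {S} {S′} S≗S′ (f , m) = f , record
      { closed       = λ v∈S′ → to (closed (from v∈S′))
      ; fixpointFree = fixpointFree ∘ from
      ; adjacent     = adjacent ∘ from
      ; involutive   = involutive ∘ from
      }
      where
      open IsMatching m
      to : ∀ {v} → T (S v) → T (S′ v)
      to = subst T (S≗S′ _)
      from : ∀ {v} → T (S′ v) → T (S v)
      from = subst T (sym (S≗S′ _))

vertexCondition⇔ : ∀ {b x d y e} →
  T (not b ∨ (x ∧ not d ∧ y ∧ e)) ⇔ (T b → T x × ¬ T d × T y × T e)
vertexCondition⇔ = mk⇔ to from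
  where
  to : ∀ {b x d y e} → T (not b ∨ (x ∧ not d ∧ y ∧ e)) → T b → T x × ¬ T d × T y × T e
  to {true} {true} {false} {true} {true} _ _ = tt , (λ ()) , tt , tt
  from : ∀ {b x d y e} → (T b → T x × ¬ T d × T y × T e) → T (not b ∨ (x ∧ not d ∧ y ∧ e))
  from {false} _ = tt
  from {true} h with h tt
  ... | x , ¬d , y , e = conjunction x ¬d y e
    where
    conjunction : ∀ {x d y e} → T x → ¬ T d → T y → T e → T (x ∧ not d ∧ y ∧ e)
    conjunction {true} {false} {true} {true} _ _ _ _ = tt
    conjunction {d = true} _ ¬d _ _ = contradiction tt ¬d

module _ (adj : Adj n) (S : Subset n) where

  isPerfectMatching⇔ : ∀ fv → T (isPerfectMatching adj S fv) ⇔ IsMatching adj (lookup S) (lookup fv)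
  isPerfectMatching⇔ fv = mk⇔ to from
    where
    to : T (isPerfectMatching adj S fv) → IsMatching adj (lookup S) (lookup fv)
    to h = record
      { closed       = λ v∈S → proj₁ (at v∈S)
      ; fixpointFree = λ v∈S fv≡v → proj₁ (proj₂ (at v∈S)) (Equivalence.from T-== fv≡v)
      ; adjacent     = λ v∈S → proj₁ (proj₂ (proj₂ (at v∈S)))
      ; involutive   = λ v∈S → Equivalence.to T-== (proj₂ (proj₂ (proj₂ (at v∈S))))
      }
      where
      at : ∀ {v} → T (lookup S v) → _
      at {v} = Equivalence.to vertexCondition⇔ (All.lookup (all⁺ _ (allFin n) h) (∈-allFin v))
    from : IsMatching adj (lookup S) (lookup fv) → T (isPerfectMatching adj S fv)
    from m = all⁻ _ {xs = allFin n} (All.tabulate λ {v} _ → Equivalence.from vertexCondition⇔ λ v∈S →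
      closed v∈S , fixpointFree v∈S ∘ Equivalence.to T-== , adjacent v∈S , Equivalence.from T-== (involutive v∈S))
      where open IsMatching m

allVecs-complete : {A : Set} (xs : List A) (v : Vec A n) → (∀ i → lookup v i ∈ xs) → v ∈ allVecs xs n
allVecs-complete xs []      _  = Any.here refl
allVecs-complete xs (x ∷ v) ∈xs = ∈-concatMap⁺ _ (Any.map (λ { refl → ∈-map⁺ (x ∷_) rest }) (∈xs zero))
  where rest = allVecs-complete xs v (∈xs ∘ suc)

perfectlyMatchable⇔ : (adj : Adj n) (S : Subset n) → T (perfectlyMatchable adj S) ⇔ Matchable adj (lookup S)
perfectlyMatchable⇔ {n} adj S = mk⇔ to from
  where
  to : T (perfectlyMatchable adj S) → Matchable adj (lookup S)
  to h with Any.satisfied (any⁻ _ (allVecs (allFin n) n) h)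
  ... | fv , isPM = lookup fv , Equivalence.to (isPerfectMatching⇔ adj S fv) isPM
  from : Matchable adj (lookup S) → T (perfectlyMatchable adj S)
  from (f , m) = any⁺ _ (lose (allVecs-complete (allFin n) (tabulate f) (∈-allFin ∘ lookup (tabulate f)))
    (Equivalence.from (isPerfectMatching⇔ adj S (tabulate f)) (IsMatching-≗ (sym ∘ lookup∘tabulate f) m)))

IsMatching-restrict : ∀ {adj : Adj n} {S S′ f} → IsMatching adj S f →
  (∀ {v} → T (S′ v) → T (S v)) → (∀ {v} → T (S′ v) → T (S′ (f v))) → IsMatching adj S′ f
IsMatching-restrict m S′⊆S S′-closed = record
  { closed       = S′-closed
  ; fixpointFree = fixpointFree ∘ S′⊆S
  ; adjacent     = adjacent ∘ S′⊆S
  ; involutive   = involutive ∘ S′⊆S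
  }
  where open IsMatching m

_∩_ _∖_ : (Fin n → Bool) → (Fin n → Bool) → Fin n → Bool
(S ∩ A) v = S v ∧ A v
(S ∖ A) v = S v ∧ not (A v)

module _ (S A : Fin n → Bool) where

  ∈∩ : ∀ {v} → T (S v) → T (A v) → T ((S ∩ A) v)
  ∈∩ v∈S v∈A = Equivalence.from T-∧ (v∈S , v∈A)

  ∈∖ : ∀ {v} → T (S v) → ¬ T (A v) → T ((S ∖ A) v)
  ∈∖ v∈S v∉A = Equivalence.from T-∧ (v∈S , Equivalence.from T-not v∉A)

  ∈∖⇒∉ : ∀ {v} → T ((S ∖ A) v) → ¬ T (A v)
  ∈∖⇒∉ = Equivalence.to T-not ∘ proj₂ ∘ Equivalence.to T-∧

  ∈∩⇒∈ : ∀ {v} → T ((S ∩ A) v) → T (A v)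
  ∈∩⇒∈ = proj₂ ∘ Equivalence.to T-∧

module _ {adj : Adj n} {S : Fin n → Bool} (A : Fin n → Bool) where

  IsMatching-split : ∀ {f} → IsMatching adj S f → (∀ {v} → T (S v) → T (A v) → T (A (f v))) →
                     IsMatching adj (S ∩ A) f × IsMatching adj (S ∖ A) f
  IsMatching-split m A-closed =
      IsMatching-restrict m inS (λ v∈ → ∈∩ S A (closed (inS v∈)) (A-closed (inS v∈) (∈∩⇒∈ S A v∈)))
    , IsMatching-restrict m inS (λ v∈ → ∈∖ S A (closed (inS v∈)) λ fv∈A →
        ∈∖⇒∉ S A v∈ (subst (T ∘ A) (involutive (inS v∈)) (A-closed (closed (inS v∈)) fv∈A)))
    where
    open IsMatching m
    inS : ∀ {B v} → T (S v ∧ B) → T (S v)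
    inS = proj₁ ∘ Equivalence.to T-∧

  matchable-join : Matchable adj (S ∩ A) → Matchable adj (S ∖ A) → Matchable adj S
  matchable-join (f , mf) (g , mg) = h , record
    { closed       = λ v∈S → proj₁ (step v∈S)
    ; fixpointFree = λ v∈S → proj₁ (proj₂ (step v∈S))
    ; adjacent     = λ v∈S → proj₁ (proj₂ (proj₂ (step v∈S)))
    ; involutive   = λ v∈S → proj₂ (proj₂ (proj₂ (step v∈S)))
    }
    where
    h : Fin n → Fin n
    h v = if A v then f v else g v
    MatchedAt : Fin n → Set
    MatchedAt v = T (S (h v)) × h v ≢ v × T (adj v (h v)) × h (h v) ≡ v
    piece : ∀ {P k} → IsMatching adj P k → (∀ {v} → T (P v) → T (S v) × h v ≡ k v) →
            ∀ {v} → T (P v) → MatchedAt v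
    piece mk agree {v} v∈P =
        subst (T ∘ S) (sym hv) (proj₁ (agree (closed v∈P)))
      , (λ hv≡v → fixpointFree v∈P (trans (sym hv) hv≡v))
      , subst (T ∘ adj v) (sym hv) (adjacent v∈P)
      , trans (cong h hv) (trans (proj₂ (agree (closed v∈P))) (involutive v∈P))
      where
      open IsMatching mk
      hv = proj₂ (agree v∈P)
    step : ∀ {v} → T (S v) → MatchedAt v
    step {v} v∈S with T? (A v)
    ... | yes v∈A = piece mf (λ v∈ → proj₁ (Equivalence.to T-∧ v∈) , if-T (∈∩⇒∈ S A v∈)) (∈∩ S A v∈S v∈A)
    ... | no v∉A  = piece mg (λ v∈ → proj₁ (Equivalence.to T-∧ v∈) , if-¬T (∈∖⇒∉ S A v∈)) (∈∖ S A v∈S v∉A)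

module _ {a b} {adj : Adj a} {adj′ : Adj b} (φ : Fin a → Fin b) (ψ : Fin b → Maybe (Fin a))
         (ψ∘φ : ∀ x → ψ (φ x) ≡ just x) (adj′∘φ : ∀ {x y} → x ≢ y → adj′ (φ x) (φ y) ≡ adj x y)
         {S′ : Fin b → Bool} (S′⊆φ : ∀ {y} → T (S′ y) → ∃ λ x → φ x ≡ y) where

  private
    φ-injective : ∀ {x y} → φ x ≡ φ y → x ≡ y
    φ-injective {x} {y} eq = just-injective (trans (sym (ψ∘φ x)) (trans (cong ψ eq) (ψ∘φ y)))

    conjugate : ∀ {f f′} → (∀ {x} → T (S′ (φ x)) → φ (f x) ≡ f′ (φ x)) →
                IsMatching adj (S′ ∘ φ) f ⇔ IsMatching adj′ S′ f′
    conjugate {f} {f′} φf≡f′φ = mk⇔ to from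
      where
      to : IsMatching adj (S′ ∘ φ) f → IsMatching adj′ S′ f′
      to m = record
        { closed       = λ y∈ → at y∈ λ x∈ → subst (T ∘ S′) (φf≡f′φ x∈) (closed x∈)
        ; fixpointFree = λ y∈ → at y∈ λ x∈ eq → fixpointFree x∈ (φ-injective (trans (φf≡f′φ x∈) eq))
        ; adjacent     = λ y∈ → at y∈ λ {x} x∈ →
            subst (T ∘ adj′ (φ x)) (φf≡f′φ x∈) (subst T (sym (adj′∘φ (fixpointFree x∈ ∘ sym))) (adjacent x∈))
        ; involutive   = λ y∈ → at y∈ λ {x} x∈ → begin
            f′ (f′ (φ x))  ≡⟨ cong f′ (sym (φf≡f′φ x∈)) ⟩
            f′ (φ (f x))   ≡⟨ sym (φf≡f′φ (closed x∈)) ⟩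
            φ (f (f x))    ≡⟨ cong φ (involutive x∈) ⟩
            φ x            ∎
        }
        where
        open IsMatching m
        open ≡-Reasoning
        at : ∀ {P : Fin b → Set} {y} → T (S′ y) → (∀ {x} → T (S′ (φ x)) → P (φ x)) → P y
        at y∈ k with S′⊆φ y∈
        ... | x , refl = k y∈
      from : IsMatching adj′ S′ f′ → IsMatching adj (S′ ∘ φ) f
      from m = record
        { closed       = λ x∈ → subst (T ∘ S′) (sym (φf≡f′φ x∈)) (closed x∈)
        ; fixpointFree = fixpointFree′
        ; adjacent     = λ {x} x∈ → subst T (adj′∘φ (fixpointFree′ x∈ ∘ sym))
            (subst (T ∘ adj′ (φ x)) (sym (φf≡f′φ x∈)) (adjacent x∈))
        ; involutive   = λ {x} x∈ → φ-injective (begin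
            φ (f (f x))    ≡⟨ φf≡f′φ (subst (T ∘ S′) (sym (φf≡f′φ x∈)) (closed x∈)) ⟩
            f′ (φ (f x))   ≡⟨ cong f′ (φf≡f′φ x∈) ⟩
            f′ (f′ (φ x))  ≡⟨ involutive x∈ ⟩
            φ x            ∎)
        }
        where
        open IsMatching m
        open ≡-Reasoning
        fixpointFree′ : ∀ {x} → T (S′ (φ x)) → f x ≢ x
        fixpointFree′ x∈ eq = fixpointFree x∈ (trans (sym (φf≡f′φ x∈)) (cong φ eq))

  matchable-transport : Matchable adj (S′ ∘ φ) ⇔ Matchable adj′ S′
  matchable-transport = mk⇔
    (λ (f , m) → _ , Equivalence.to (conjugate {f′ = push f} (push-conjugates f)) m)
    (λ (f′ , m′) → _ , Equivalence.from (conjugate {f = pull f′} (pull-conjugates f′ m′)) m′)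
    where
    push : (Fin a → Fin a) → Fin b → Fin b
    push f y = maybe′ (φ ∘ f) y (ψ y)
    pull : (Fin b → Fin b) → Fin a → Fin a
    pull f′ x = maybe′ (λ x′ → x′) x (ψ (f′ (φ x)))
    push-conjugates : ∀ f {x} → T (S′ (φ x)) → φ (f x) ≡ push f (φ x)
    push-conjugates f {x} _ rewrite ψ∘φ x = refl
    pull-conjugates : ∀ f′ → IsMatching adj′ S′ f′ → ∀ {x} → T (S′ (φ x)) → φ (pull f′ x) ≡ f′ (φ x)
    pull-conjugates f′ m′ x∈ with S′⊆φ (IsMatching.closed m′ x∈)
    ... | x′ , eq rewrite sym eq | ψ∘φ x′ = refl

-- Matchable sets have even size

Even : ℕ → Set
Even k = ∃ λ q → k ≡ q + q

¬Even-suc : ∀ {k} → Even k → ¬ Even (suc k)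
¬Even-suc (zero , refl) (zero , ())
¬Even-suc (zero , refl) (suc q , eq) = contradiction (trans (suc-injective eq) (+-suc q q)) λ ()
¬Even-suc (suc p , refl) (zero , ())
¬Even-suc (suc p , refl) (suc q , eq) =
  ¬Even-suc (p , refl) (q , suc-injective (trans (cong suc (sym (+-suc p p))) (trans (suc-injective eq) (+-suc q q))))

module _ (S : Subset n) (v : Fin n) where

  ∈-[]≔false : ∀ {x} → T (lookup (S [ v ]≔ false) x) → x ≢ v × T (lookup S x)
  ∈-[]≔false {x} x∈ with x ≟ v
  ... | yes refl = contradiction (subst T (lookup∘update v S false) x∈) λ ()
  ... | no x≢v   = x≢v , subst T (lookup∘update′ x≢v S false) x∈

  []≔false-∈ : ∀ {x} → x ≢ v → T (lookup S x) → T (lookup (S [ v ]≔ false) x)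
  []≔false-∈ x≢v = subst T (sym (lookup∘update′ x≢v S false))

size-[]≔false : (S : Subset n) (v : Fin n) → T (lookup S v) → size S ≡ suc (size (S [ v ]≔ false))
size-[]≔false (true ∷ S)  zero    _  = refl
size-[]≔false (true ∷ S)  (suc v) v∈ = cong suc (size-[]≔false S v v∈)
size-[]≔false (false ∷ S) (suc v) v∈ = size-[]≔false S v v∈

∃-∈-size-suc : ∀ {k} (S : Subset n) → size S ≡ suc k → ∃ (T ∘ lookup S)
∃-∈-size-suc (true ∷ S)  _  = zero , tt
∃-∈-size-suc (false ∷ S) eq = let v , v∈ = ∃-∈-size-suc S eq in suc v , v∈

module _ {adj : Adj n} where

  removeMatchedPair : ∀ {k} (S : Subset n) → size S ≡ suc k → Matchable adj (lookup S) →
    ∃ λ S′ → size S ≡ suc (suc (size S′)) × Matchable adj (lookup S′)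
  removeMatchedPair S size≡ (f , m) =
      S₂
    , trans (size-[]≔false S v v∈S) (cong suc (size-[]≔false S₁ (f v) fv∈S₁))
    , f , IsMatching-restrict m (proj₂ ∘ proj₂ ∘ ∈S₂) closed₂
    where
    open IsMatching m
    v = proj₁ (∃-∈-size-suc S size≡)
    v∈S = proj₂ (∃-∈-size-suc S size≡)
    S₁ = S [ v ]≔ false
    S₂ = S₁ [ f v ]≔ false
    fv∈S₁ : T (lookup S₁ (f v))
    fv∈S₁ = []≔false-∈ S v (fixpointFree v∈S) (closed v∈S)
    ∈S₂ : ∀ {x} → T (lookup S₂ x) → x ≢ f v × x ≢ v × T (lookup S x)
    ∈S₂ x∈ = let x≢fv , x∈S₁ = ∈-[]≔false S₁ (f v) x∈ in x≢fv , ∈-[]≔false S v x∈S₁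
    closed₂ : ∀ {x} → T (lookup S₂ x) → T (lookup S₂ (f x))
    closed₂ x∈ with ∈S₂ x∈
    ... | x≢fv , x≢v , x∈S =
      []≔false-∈ S₁ (f v) (λ fx≡fv → x≢v (trans (sym (involutive x∈S)) (trans (cong f fx≡fv) (involutive v∈S))))
        ([]≔false-∈ S v (λ fx≡v → x≢fv (trans (sym (involutive x∈S)) (cong f fx≡v))) (closed x∈S))

  matchable⇒even : (S : Subset n) → Matchable adj (lookup S) → Even (size S)
  matchable⇒even S = go (size S) S refl
    where
    go : ∀ k (S : Subset n) → size S ≡ k → Matchable adj (lookup S) → Even k
    go zero          _ _  _ = 0 , refl
    go (suc zero)    S eq M with removeMatchedPair S eq M
    ... | _ , eq′ , _ = contradiction (trans (sym eq) eq′) λ ()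
    go (suc (suc k)) S eq M with removeMatchedPair S eq M
    ... | S′ , eq′ , M′ with go k S′ (suc-injective (suc-injective (trans (sym eq′) eq))) M′
    ... | q , k≡q+q = suc q , cong suc (trans (cong suc k≡q+q) (sym (+-suc q q)))

punchOut? : Fin (suc n) → Fin (suc n) → Maybe (Fin n)
punchOut? u y with u ≟ y
... | yes _   = nothing
... | no u≢y = just (punchOut u≢y)

punchOut?-punchIn : (u : Fin (suc n)) (j : Fin n) → punchOut? u (punchIn u j) ≡ just j
punchOut?-punchIn u j with u ≟ punchIn u j
... | yes u≡ = contradiction (sym u≡) (punchInᵢ≢i u j)
... | no u≢  = cong just (trans (punchOut-cong u refl) (punchOut-punchIn u))

data Punched (u : Fin (suc n)) : Fin (suc n) → Set where
  hole    : Punched u u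
  punched : ∀ j → Punched u (punchIn u j)

punched? : (u y : Fin (suc n)) → Punched u y
punched? u y with u ≟ y
... | yes refl = hole
... | no u≢y  = subst (Punched u) (punchIn-punchOut u≢y) (punched (punchOut u≢y))

∈-insertAt-false : (s : Subset n) (u : Fin (suc n)) {y : Fin (suc n)} →
  T (lookup (insertAt s u false) y) → ∃ λ j → punchIn u j ≡ y
∈-insertAt-false s u {y} y∈ with punched? u y
... | hole      = contradiction (subst T (insertAt-lookup s u false) y∈) λ ()
... | punched j = j , refl

perfectlyMatchable-deleteVertex : (G : Adj (suc n)) (u : Fin (suc n)) (s : Subset n) →
  perfectlyMatchable (deleteVertex G u) s ≡ perfectlyMatchable G (insertAt s u false)
perfectlyMatchable-deleteVertex G u s = T-⇔⇒≡ (
  ⇔-trans (perfectlyMatchable⇔ (deleteVertex G u) s) (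
  ⇔-trans (Matchable-≗ (sym ∘ insertAt-punchIn s u false)) (
  ⇔-trans (matchable-transport (punchIn u) (punchOut? u) (punchOut?-punchIn u) (λ _ → refl)
                               (∈-insertAt-false s u))
          (⇔-sym (perfectlyMatchable⇔ G (insertAt s u false))))))

module Gluing {n m : ℕ} (G : Adj (suc n)) (u : Fin (suc n)) (H : Adj (suc m)) (w : Fin (suc m)) where

  G′ : Adj (suc n + m)
  G′ = glue G u H w

  ιG : Fin (suc n) → Fin (suc n + m)
  ιG a = a ↑ˡ m

  ιR : Fin m → Fin (suc n + m)
  ιR j = suc n ↑ʳ j

  ιH : Fin (suc m) → Fin (suc n + m)
  ιH y = maybe′ ιR (ιG u) (punchOut? w y)

  ιH-hole : ιH w ≡ ιG u
  ιH-hole with w ≟ w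
  ... | yes _   = refl
  ... | no w≢w = contradiction refl w≢w

  ιH-punched : ∀ j → ιH (punchIn w j) ≡ ιR j
  ιH-punched j = cong (maybe′ ιR (ιG u)) (punchOut?-punchIn w j)

  gPart : Fin (suc n + m) → Fin (suc n)
  gPart x = [ (λ a → a) , const u ]′ (splitAt (suc n) x)

  hPart : Fin (suc n + m) → Fin (suc m)
  hPart x = [ const w , punchIn w ]′ (splitAt (suc n) x)

  side : ∀ x → (∃ λ a → ιG a ≡ x) ⊎ (∃ λ j → ιR j ≡ x)
  side x with splitAt (suc n) x in eq
  ... | inj₁ a = inj₁ (a , splitAt⁻¹-↑ˡ eq)
  ... | inj₂ j = inj₂ (j , splitAt⁻¹-↑ʳ eq)

  ιG≢ιR : ∀ a j → ιG a ≢ ιR j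
  ιG≢ιR a j eq with trans (sym (splitAt-↑ˡ (suc n) a m)) (trans (cong (splitAt (suc n)) eq) (splitAt-↑ʳ (suc n) m j))
  ... | ()

  gPart-ιG : ∀ a → gPart (ιG a) ≡ a
  gPart-ιG a rewrite splitAt-↑ˡ (suc n) a m = refl

  hPart-ιH : ∀ y → hPart (ιH y) ≡ y
  hPart-ιH y with punched? w y
  ... | hole      rewrite ιH-hole | splitAt-↑ˡ (suc n) u m = refl
  ... | punched j rewrite ιH-punched j | splitAt-↑ʳ (suc n) m j = refl

  G′-ιG-ιG : ∀ a b → G′ (ιG a) (ιG b) ≡ G a b
  G′-ιG-ιG a b rewrite splitAt-↑ˡ (suc n) a m | splitAt-↑ˡ (suc n) b m = refl

  G′-ιG-ιR : ∀ a j → G′ (ιG a) (ιR j) ≡ (if a == u then H w (punchIn w j) else false)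
  G′-ιG-ιR a j rewrite splitAt-↑ˡ (suc n) a m | splitAt-↑ʳ (suc n) m j = refl

  G′-ιR-ιG : ∀ j b → G′ (ιR j) (ιG b) ≡ (if b == u then H (punchIn w j) w else false)
  G′-ιR-ιG j b rewrite splitAt-↑ʳ (suc n) m j | splitAt-↑ˡ (suc n) b m = refl

  G′-ιR-ιR : ∀ i j → G′ (ιR i) (ιR j) ≡ H (punchIn w i) (punchIn w j)
  G′-ιR-ιR i j rewrite splitAt-↑ʳ (suc n) m i | splitAt-↑ʳ (suc n) m j = refl

  G′-ιH-ιH : ∀ {y z} → y ≢ z → G′ (ιH y) (ιH z) ≡ H y z
  G′-ιH-ιH {y} {z} y≢z with punched? w y | punched? w z
  ... | hole      | hole      = contradiction refl y≢z
  ... | hole      | punched j rewrite ιH-hole | ιH-punched j = trans (G′-ιG-ιR u j) (if-T (T-==-refl u))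
  ... | punched i | hole      rewrite ιH-hole | ιH-punched i = trans (G′-ιR-ιG i u) (if-T (T-==-refl u))
  ... | punched i | punched j rewrite ιH-punched i | ιH-punched j = G′-ιR-ιR i j

  crossing-edge-at-u : ∀ a j → T (G′ (ιG a) (ιR j)) → a ≡ u
  crossing-edge-at-u a j e = Equivalence.to T-== (guard (subst T (G′-ιG-ιR a j) e))
    where
    guard : ∀ {b x} → T (if b then x else false) → T b
    guard {true} _ = tt

  isG isG⁻ : Fin (suc n + m) → Bool
  isG  x = [ const true , const false ]′ (splitAt (suc n) x)
  isG⁻ x = [ (λ a → not (a == u)) , const false ]′ (splitAt (suc n) x)

  isG-ιG : ∀ a → isG (ιG a) ≡ true
  isG-ιG a rewrite splitAt-↑ˡ (suc n) a m = refl

  isG-ιR : ∀ j → isG (ιR j) ≡ false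
  isG-ιR j rewrite splitAt-↑ʳ (suc n) m j = refl

  isG⁻-ιG : ∀ a → isG⁻ (ιG a) ≡ not (a == u)
  isG⁻-ιG a rewrite splitAt-↑ˡ (suc n) a m = refl

  isG⁻-ιR : ∀ j → isG⁻ (ιR j) ≡ false
  isG⁻-ιR j rewrite splitAt-↑ʳ (suc n) m j = refl

  T-isG⁻-ιG : ∀ {a} → T (isG⁻ (ιG a)) ⇔ a ≢ u
  T-isG⁻-ιG {a} = ⇔-trans (mk⇔ (subst T (isG⁻-ιG a)) (subst T (sym (isG⁻-ιG a))))
                 (⇔-trans T-not (mk⇔ (λ ¬a≡u → ¬a≡u ∘ Equivalence.from T-==)
                                     (λ a≢u → a≢u ∘ Equivalence.to T-==)))

  isG⁻⇒isG : ∀ x → T (isG⁻ x) → T (isG x)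
  isG⁻⇒isG x x∈ with side x
  ... | inj₁ (a , refl) = subst T (sym (isG-ιG a)) tt
  ... | inj₂ (j , refl) = contradiction (subst T (isG⁻-ιR j) x∈) λ ()

  isG⇒ιG : ∀ x → T (isG x) → ∃ λ a → ιG a ≡ x
  isG⇒ιG x x∈ with side x
  ... | inj₁ image      = image
  ... | inj₂ (j , refl) = contradiction (subst T (isG-ιR j) x∈) λ ()

  ¬isG⁻⇒ιH : ∀ x → ¬ T (isG⁻ x) → ∃ λ y → ιH y ≡ x
  ¬isG⁻⇒ιH x x∉ with side x
  ... | inj₂ (j , refl) = punchIn w j , ιH-punched j
  ... | inj₁ (a , refl) with a ≟ u
  ...   | yes refl = w , ιH-hole
  ...   | no a≢u   = contradiction (Equivalence.from T-isG⁻-ιG a≢u) x∉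

  module _ {S : Fin (suc n + m) → Bool} {F : Fin (suc n + m) → Fin (suc n + m)} (mF : IsMatching G′ S F) where

    open IsMatching mF

    partner-ιG : ∀ {a} → T (S (ιG a)) → (∃ λ b → ιG b ≡ F (ιG a)) ⊎ (a ≡ u × ∃ λ j → ιR j ≡ F (ιG a))
    partner-ιG {a} a∈ with side (F (ιG a))
    ... | inj₁ image    = inj₁ image
    ... | inj₂ (j , eq) = inj₂ (crossing-edge-at-u a j (subst (T ∘ G′ (ιG a)) (sym eq) (adjacent a∈)) , j , eq)

    isG-closed : (∃ λ b → ιG b ≡ F (ιG u)) → ∀ {x} → T (S x) → T (isG x) → T (isG (F x))
    isG-closed (b , ιGb≡) {x} x∈S x∈A with isG⇒ιG x x∈A
    ... | a , refl with partner-ιG x∈S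
    ...   | inj₁ (c , eq)          = subst (T ∘ isG) eq (subst T (sym (isG-ιG c)) tt)
    ...   | inj₂ (refl , j , eq)  = contradiction (trans ιGb≡ (sym eq)) (ιG≢ιR b j)

    isG⁻-closed : (∃ λ j → ιR j ≡ F (ιG u)) → ∀ {x} → T (S x) → T (isG⁻ x) → T (isG⁻ (F x))
    isG⁻-closed (j , ιRj≡) {x} x∈S x∈A with isG⇒ιG x (isG⁻⇒isG x x∈A)
    ... | a , refl with partner-ιG x∈S
    ...   | inj₂ (a≡u , _)  = contradiction a≡u (Equivalence.to T-isG⁻-ιG x∈A)
    ...   | inj₁ (c , eq)   = subst (T ∘ isG⁻) eq (Equivalence.from T-isG⁻-ιG c≢u)
      where
      c≢u : c ≢ u
      c≢u refl = ιG≢ιR a j (begin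
        ιG a           ≡⟨ sym (involutive x∈S) ⟩
        F (F (ιG a))   ≡⟨ cong F (sym eq) ⟩
        F (ιG u)       ≡⟨ sym ιRj≡ ⟩
        ιR j           ∎)
        where open ≡-Reasoning

  module _ (S : Fin (suc n + m) → Bool) where

    G-side : ∀ A → (∀ x → T (A x) → T (isG x)) → Matchable G ((S ∩ A) ∘ ιG) ⇔ Matchable G′ (S ∩ A)
    G-side A A⊆isG = matchable-transport ιG (just ∘ gPart) (cong just ∘ gPart-ιG) (λ {a} {b} _ → G′-ιG-ιG a b)
                                         (λ {x} x∈ → isG⇒ιG x (A⊆isG x (∈∩⇒∈ S A x∈)))

    H-side : ∀ A → (∀ x → T (isG⁻ x) → T (A x)) → Matchable H ((S ∖ A) ∘ ιH) ⇔ Matchable G′ (S ∖ A)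
    H-side A isG⁻⊆A = matchable-transport ιH (just ∘ hPart) (cong just ∘ hPart-ιH) G′-ιH-ιH
                                          (λ {x} x∈ → ¬isG⁻⇒ιH x (∈∖⇒∉ S A x∈ ∘ isG⁻⊆A x))

    ∩isG∘ιG : (S ∩ isG) ∘ ιG ≗ S ∘ ιG
    ∩isG∘ιG a rewrite isG-ιG a = ∧-identityʳ _

    ∖isG∘ιH : (S ∖ isG) ∘ ιH ≗ (S ∘ ιH) ∖ (_== w)
    ∖isG∘ιH y with punched? w y
    ... | hole      rewrite ιH-hole | isG-ιG u | dec-true (w ≟ w) refl = refl
    ... | punched j rewrite ιH-punched j | isG-ιR j | dec-false (punchIn w j ≟ w) (punchInᵢ≢i w j) = refl

    ∩isG⁻∘ιG : (S ∩ isG⁻) ∘ ιG ≗ (S ∘ ιG) ∖ (_== u)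
    ∩isG⁻∘ιG a rewrite isG⁻-ιG a = refl

    ∖isG⁻∘ιH : (S ∖ isG⁻) ∘ ιH ≗ S ∘ ιH
    ∖isG⁻∘ιH y with punched? w y
    ... | hole      rewrite ιH-hole | isG⁻-ιG u | dec-true (u ≟ u) refl = ∧-identityʳ _
    ... | punched j rewrite ιH-punched j | isG⁻-ιR j = ∧-identityʳ _

    split-at-G : (Matchable G (S ∘ ιG) × Matchable H ((S ∘ ιH) ∖ (_== w)))
                 ⇔ (Matchable G′ (S ∩ isG) × Matchable G′ (S ∖ isG))
    split-at-G = ⇔-trans (Matchable-≗ (sym ∘ ∩isG∘ιG) ×-⇔ Matchable-≗ (sym ∘ ∖isG∘ιH))
                         (G-side isG (λ _ x∈ → x∈) ×-⇔ H-side isG isG⁻⇒isG)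

    split-at-G⁻ : (Matchable G ((S ∘ ιG) ∖ (_== u)) × Matchable H (S ∘ ιH))
                  ⇔ (Matchable G′ (S ∩ isG⁻) × Matchable G′ (S ∖ isG⁻))
    split-at-G⁻ = ⇔-trans (Matchable-≗ (sym ∘ ∩isG⁻∘ιG) ×-⇔ Matchable-≗ (sym ∘ ∖isG⁻∘ιH))
                          (G-side isG⁻ isG⁻⇒isG ×-⇔ H-side isG⁻ (λ _ x∈ → x∈))

    matchable-glue : Matchable G′ S ⇔ (Matchable G (S ∘ ιG) × Matchable H ((S ∘ ιH) ∖ (_== w))
                                      ⊎ Matchable G ((S ∘ ιG) ∖ (_== u)) × Matchable H (S ∘ ιH))
    matchable-glue = mk⇔ to from
      where
      -- The partner of the glued vertex decides the partition: into G (isG) or into H (isG⁻).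
      to : Matchable G′ S → _
      to (F , mF) with side (F (ιG u))
      ... | inj₁ image = inj₁ (Equivalence.from split-at-G
              (let mA , mĀ = IsMatching-split isG mF (isG-closed mF image) in (F , mA) , (F , mĀ)))
      ... | inj₂ image = inj₂ (Equivalence.from split-at-G⁻
              (let mA , mĀ = IsMatching-split isG⁻ mF (isG⁻-closed mF image) in (F , mA) , (F , mĀ)))
      from : _ → Matchable G′ S
      from (inj₁ matchings) = uncurry (matchable-join isG) (Equivalence.to split-at-G matchings)
      from (inj₂ matchings) = uncurry (matchable-join isG⁻) (Equivalence.to split-at-G⁻ matchings)

-- Counting matchable sets

⟦_⟧ : Bool → ℕ
⟦ true  ⟧ = 1
⟦ false ⟧ = 0

sumSubsets : (n : ℕ) → (Subset n → ℕ) → ℕ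
sumSubsets zero    f = f []
sumSubsets (suc n) f = sumSubsets n (f ∘ (true ∷_)) + sumSubsets n (f ∘ (false ∷_))

sumSubsets-cong : ∀ n {f g : Subset n → ℕ} → f ≗ g → sumSubsets n f ≡ sumSubsets n g
sumSubsets-cong zero    f≗g = f≗g []
sumSubsets-cong (suc n) f≗g = cong₂ _+_ (sumSubsets-cong n (f≗g ∘ (true ∷_))) (sumSubsets-cong n (f≗g ∘ (false ∷_)))

sumSubsets-+ : ∀ n (f g : Subset n → ℕ) → sumSubsets n (λ s → f s + g s) ≡ sumSubsets n f + sumSubsets n g
sumSubsets-+ zero    f g = refl
sumSubsets-+ (suc n) f g = trans (cong₂ _+_ (sumSubsets-+ n _ _) (sumSubsets-+ n _ _))
  (interchange (sumSubsets n (f ∘ (true ∷_))) (sumSubsets n (g ∘ (true ∷_))) (sumSubsets n (f ∘ (false ∷_))) _)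

sumSubsets-*ʳ : ∀ n (f : Subset n → ℕ) c → sumSubsets n f * c ≡ sumSubsets n (λ s → f s * c)
sumSubsets-*ʳ zero    f c = refl
sumSubsets-*ʳ (suc n) f c =
  trans (*-distribʳ-+ c (sumSubsets n _) _) (cong₂ _+_ (sumSubsets-*ʳ n _ c) (sumSubsets-*ʳ n _ c))

sumSubsets-0 : ∀ n → sumSubsets n (const 0) ≡ 0
sumSubsets-0 zero    = refl
sumSubsets-0 (suc n) = cong₂ _+_ (sumSubsets-0 n) (sumSubsets-0 n)

sumSubsets-insertAt : ∀ n (u : Fin (suc n)) (f : Subset (suc n) → ℕ) →
  sumSubsets (suc n) f ≡ sumSubsets n (f ∘ λ s → insertAt s u true) + sumSubsets n (f ∘ λ s → insertAt s u false)
sumSubsets-insertAt n       zero    f = refl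
sumSubsets-insertAt (suc n) (suc u) f =
  trans (cong₂ _+_ (sumSubsets-insertAt n u (f ∘ (true ∷_))) (sumSubsets-insertAt n u (f ∘ (false ∷_))))
        (interchange (sumSubsets n (f ∘ (true ∷_) ∘ λ s → insertAt s u true))
                     (sumSubsets n (f ∘ (true ∷_) ∘ λ s → insertAt s u false))
                     (sumSubsets n (f ∘ (false ∷_) ∘ λ s → insertAt s u true)) _)

sumSubsets-++ : ∀ a b (f : Subset (a + b) → ℕ) → sumSubsets (a + b) f ≡ sumSubsets a (λ s → sumSubsets b (f ∘ (s ++_)))
sumSubsets-++ zero    b f = refl
sumSubsets-++ (suc a) b f = cong₂ _+_ (sumSubsets-++ a b _) (sumSubsets-++ a b _)

length-filterᵇ : {A : Set} (P : A → Bool) (xs : List A) → length (filterᵇ P xs) ≡ sum (map (⟦_⟧ ∘ P) xs)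
length-filterᵇ P []       = refl
length-filterᵇ P (x ∷ xs) with P x
... | true  = cong suc (length-filterᵇ P xs)
... | false = length-filterᵇ P xs

sum-map-allSubsets : ∀ n (f : Subset n → ℕ) → sum (map f (allSubsets n)) ≡ sumSubsets n f
sum-map-allSubsets zero    f = +-identityʳ (f [])
sum-map-allSubsets (suc n) f = begin
  sum (map f (map (true ∷_) L ++ᴸ (map (false ∷_) L ++ᴸ [])))
    ≡⟨ cong (λ xs → sum (map f (map (true ∷_) L ++ᴸ xs))) (++-identityʳ _) ⟩
  sum (map f (map (true ∷_) L ++ᴸ map (false ∷_) L))
    ≡⟨ cong sum (map-++ f (map (true ∷_) L) _) ⟩
  sum (map f (map (true ∷_) L) ++ᴸ map f (map (false ∷_) L))
    ≡⟨ sum-++ (map f (map (true ∷_) L)) _ ⟩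
  sum (map f (map (true ∷_) L)) + sum (map f (map (false ∷_) L))
    ≡⟨ cong₂ _+_ (cong sum (sym (map-∘ L))) (cong sum (sym (map-∘ L))) ⟩
  sum (map (f ∘ (true ∷_)) L) + sum (map (f ∘ (false ∷_)) L)
    ≡⟨ cong₂ _+_ (sum-map-allSubsets n _) (sum-map-allSubsets n _) ⟩
  sumSubsets (suc n) f ∎
  where
  open ≡-Reasoning
  L = allSubsets n

countSubsets : ∀ n (P : Subset n → Bool) → length (filterᵇ P (allSubsets n)) ≡ sumSubsets n (⟦_⟧ ∘ P)
countSubsets n P = trans (length-filterᵇ P (allSubsets n)) (sum-map-allSubsets n (⟦_⟧ ∘ P))

size-insertAt : (s : Subset n) (u : Fin (suc n)) (b : Bool) → size (insertAt s u b) ≡ ⟦ b ⟧ + size s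
size-insertAt s           zero    true  = refl
size-insertAt s           zero    false = refl
size-insertAt (true ∷ s)  (suc u) b     = trans (cong suc (size-insertAt s u b)) (sym (+-suc ⟦ b ⟧ (size s)))
size-insertAt (false ∷ s) (suc u) b     = size-insertAt s u b

size-++ : ∀ {a b} (s : Subset a) (t : Subset b) → size (s ++ t) ≡ size s + size t
size-++ []          t = refl
size-++ (true ∷ s)  t = cong suc (size-++ s t)
size-++ (false ∷ s) t = size-++ s t

sumUpToℕ : ℕ → (ℕ → ℕ) → ℕ
sumUpToℕ zero    f = f 0
sumUpToℕ (suc k) f = sumUpToℕ k f + f (suc k)

sumUpTo-cong : ∀ k {f g : ℕ → ℤ} → (∀ i → f i ≡ g i) → sumUpTo k f ≡ sumUpTo k g
sumUpTo-cong zero    f≗g = f≗g 0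
sumUpTo-cong (suc k) f≗g = cong₂ _+ℤ_ (sumUpTo-cong k f≗g) (f≗g (suc k))

sumUpTo-pos : ∀ k (f : ℕ → ℕ) → sumUpTo k (+_ ∘ f) ≡ + sumUpToℕ k f
sumUpTo-pos zero    f = refl
sumUpTo-pos (suc k) f = trans (cong (_+ℤ + f (suc k)) (sumUpTo-pos k f)) (sym (pos-+ (sumUpToℕ k f) (f (suc k))))

sumUpToℕ-cong : ∀ k {f g : ℕ → ℕ} → (∀ i → f i ≡ g i) → sumUpToℕ k f ≡ sumUpToℕ k g
sumUpToℕ-cong zero    f≗g = f≗g 0
sumUpToℕ-cong (suc k) f≗g = cong₂ _+_ (sumUpToℕ-cong k f≗g) (f≗g (suc k))

sumUpToℕ-+ : ∀ k (f g : ℕ → ℕ) → sumUpToℕ k (λ i → f i + g i) ≡ sumUpToℕ k f + sumUpToℕ k g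
sumUpToℕ-+ zero    f g = refl
sumUpToℕ-+ (suc k) f g = trans (cong (_+ (f (suc k) + g (suc k))) (sumUpToℕ-+ k f g))
                               (interchange (sumUpToℕ k f) (sumUpToℕ k g) (f (suc k)) (g (suc k)))

sumUpToℕ-0 : ∀ k → sumUpToℕ k (const 0) ≡ 0
sumUpToℕ-0 zero    = refl
sumUpToℕ-0 (suc k) = cong (_+ 0) (sumUpToℕ-0 k)

sumUpToℕ-sumSubsets : ∀ k n (g : ℕ → Subset n → ℕ) →
  sumUpToℕ k (λ i → sumSubsets n (g i)) ≡ sumSubsets n (λ s → sumUpToℕ k (λ i → g i s))
sumUpToℕ-sumSubsets zero    n g = refl
sumUpToℕ-sumSubsets (suc k) n g = trans (cong (_+ sumSubsets n (g (suc k))) (sumUpToℕ-sumSubsets k n g))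
                                        (sym (sumSubsets-+ n _ (g (suc k))))

_⋆_ : (ℕ → ℕ) → (ℕ → ℕ) → ℕ → ℕ
(f ⋆ g) k = sumUpToℕ k (λ i → f i * g (k ∸ i))

*ₚ-pos : ∀ {f g : Poly} {f′ g′ : ℕ → ℕ} → (∀ i → f i ≡ + f′ i) → (∀ i → g i ≡ + g′ i) →
         ∀ k → (f *ₚ g) k ≡ + (f′ ⋆ g′) k
*ₚ-pos {f′ = f′} {g′} f≡ g≡ k =
  trans (sumUpTo-cong k λ i → trans (cong₂ _*ℤ_ (f≡ i) (g≡ (k ∸ i))) (sym (pos-* (f′ i) (g′ (k ∸ i)))))
        (sumUpTo-pos k _)

⋆-expand : ∀ (c a d b : ℕ → ℕ) k →
  ((λ i → c i + a i) ⋆ (λ i → d i + b i)) k ≡ (c ⋆ d) k + ((c ⋆ b) k + (a ⋆ d) k + (a ⋆ b) k)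
⋆-expand c a d b k = begin
  sumUpToℕ k (λ i → (c i + a i) * (d (k ∸ i) + b (k ∸ i)))
    ≡⟨ sumUpToℕ-cong k (λ i → expand (c i) (a i) (d (k ∸ i)) (b (k ∸ i))) ⟩
  sumUpToℕ k (λ i → c i * d (k ∸ i) + ((c i * b (k ∸ i) + a i * d (k ∸ i)) + a i * b (k ∸ i)))
    ≡⟨ sumUpToℕ-+ k _ _ ⟩
  (c ⋆ d) k + sumUpToℕ k (λ i → (c i * b (k ∸ i) + a i * d (k ∸ i)) + a i * b (k ∸ i))
    ≡⟨ cong (λ z → (c ⋆ d) k + z) (trans (sumUpToℕ-+ k _ _) (cong (_+ (a ⋆ b) k) (sumUpToℕ-+ k _ _))) ⟩
  (c ⋆ d) k + ((c ⋆ b) k + (a ⋆ d) k + (a ⋆ b) k) ∎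
  where
  open ≡-Reasoning
  expand : ∀ c a d b → (c + a) * (d + b) ≡ c * d + ((c * b + a * d) + a * b)
  expand = solve-∀

gradedCount : ∀ n → (Subset n → Bool) → (Subset n → ℕ) → ℕ → ℕ
gradedCount n P σ i = sumSubsets n (λ s → ⟦ P s ∧ (σ s ≡ᵇ i + i) ⟧)

≡ᵇ-refl : ∀ m → (m ≡ᵇ m) ≡ true
≡ᵇ-refl m = dec-true (m ℕ.≟ m) refl

≡ᵇ-≢ : ∀ {m n} → m ≢ n → (m ≡ᵇ n) ≡ false
≡ᵇ-≢ {m} {n} = dec-false (m ℕ.≟ n)

double-<⇒≢ : ∀ {m n} → m < n → m + m ≢ n + n
double-<⇒≢ m<n = <⇒≢ (+-mono-< m<n m<n)

sumUpToℕ-select-out : ∀ k q (c : ℕ → ℕ) → k < q → sumUpToℕ k (λ i → ⟦ q + q ≡ᵇ i + i ⟧ * c i) ≡ 0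
sumUpToℕ-select-out zero    q c 0<q rewrite ≡ᵇ-≢ (≢-sym (double-<⇒≢ 0<q)) = refl
sumUpToℕ-select-out (suc k) q c k<q rewrite ≡ᵇ-≢ (≢-sym (double-<⇒≢ k<q)) =
  trans (+-identityʳ _) (sumUpToℕ-select-out k q c (<-trans (n<1+n k) k<q))

sumUpToℕ-select : ∀ k q (c : ℕ → ℕ) → q ≤ k → sumUpToℕ k (λ i → ⟦ q + q ≡ᵇ i + i ⟧ * c i) ≡ c q
sumUpToℕ-select zero    zero c _ = +-identityʳ (c 0)
sumUpToℕ-select (suc k) q c q≤1+k with q ≤? k
... | yes q≤k rewrite ≡ᵇ-≢ (double-<⇒≢ (s≤s q≤k)) = trans (+-identityʳ _) (sumUpToℕ-select k q c q≤k)
... | no q≰k with ≤-antisym q≤1+k (≰⇒> q≰k)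
...   | refl rewrite ≡ᵇ-refl (suc k + suc k) =
  trans (cong (_+ (c (suc k) + 0)) (sumUpToℕ-select-out k (suc k) c ≤-refl)) (+-identityʳ _)

≡ᵇ-cong⇔ : ∀ {m n m′ n′} → (m ≡ n ⇔ m′ ≡ n′) → (m ≡ᵇ n) ≡ (m′ ≡ᵇ n′)
≡ᵇ-cong⇔ {m} {n} {m′} {n′} e = T-⇔⇒≡ (⇔-trans (mk⇔ (≡ᵇ⇒≡ m n) (≡⇒≡ᵇ m n)) (⇔-trans e (mk⇔ (≡⇒≡ᵇ m′ n′) (≡ᵇ⇒≡ m′ n′))))

remainingHalf : ∀ {q k} → q ≤ k → ∀ x → (q + q + x ≡ᵇ k + k) ≡ (x ≡ᵇ (k ∸ q) + (k ∸ q))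
remainingHalf {q} {k} q≤k x = ≡ᵇ-cong⇔ (mk⇔ (λ e → +-cancelˡ-≡ (q + q) x (d + d) (trans e k+k≡))
                                            (λ e → trans (cong (λ z → q + q + z) e) (sym k+k≡)))
  where
  d = k ∸ q
  k+k≡ : k + k ≡ (q + q) + (d + d)
  k+k≡ = trans (cong (λ z → z + z) (sym (m+[n∸m]≡n q≤k))) (interchange q d q d)

module _ {a b} (P : Subset a → Bool) (σ : Subset a → ℕ) (Q : Subset b → Bool) (τ : Subset b → ℕ) where

  -- Without evenness, pairs with σ s odd and σ s + τ t even would be missing on the right.
  sumSubsets²≡⋆ : (∀ s → T (P s) → Even (σ s)) → ∀ k →
    sumSubsets a (λ s → sumSubsets b (λ t → ⟦ P s ∧ Q t ∧ (σ s + τ t ≡ᵇ k + k) ⟧))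
    ≡ (gradedCount a P σ ⋆ gradedCount b Q τ) k
  sumSubsets²≡⋆ even k = sym (begin
    sumUpToℕ k (λ i → gradedCount a P σ i * N i)
      ≡⟨ sumUpToℕ-cong k (λ i → sumSubsets-*ʳ a _ (N i)) ⟩
    sumUpToℕ k (λ i → sumSubsets a (λ s → ⟦ P s ∧ (σ s ≡ᵇ i + i) ⟧ * N i))
      ≡⟨ sumUpToℕ-sumSubsets k a _ ⟩
    sumSubsets a (λ s → sumUpToℕ k (λ i → ⟦ P s ∧ (σ s ≡ᵇ i + i) ⟧ * N i))
      ≡⟨ sumSubsets-cong a (sym ∘ pairsWith) ⟩
    sumSubsets a (λ s → sumSubsets b (λ t → ⟦ P s ∧ Q t ∧ (σ s + τ t ≡ᵇ k + k) ⟧)) ∎)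
    where
    open ≡-Reasoning
    N : ℕ → ℕ
    N i = gradedCount b Q τ (k ∸ i)
    pairsWithHalf : ∀ q → sumSubsets b (λ t → ⟦ Q t ∧ (q + q + τ t ≡ᵇ k + k) ⟧)
                          ≡ sumUpToℕ k (λ i → ⟦ q + q ≡ᵇ i + i ⟧ * N i)
    pairsWithHalf q with q ≤? k
    ... | yes q≤k = trans (sumSubsets-cong b λ t → cong (λ e → ⟦ Q t ∧ e ⟧) (remainingHalf q≤k (τ t)))
                          (sym (sumUpToℕ-select k q N q≤k))
    ... | no q≰k = trans (sumSubsets-cong b tooBig) (trans (sumSubsets-0 b) (sym (sumUpToℕ-select-out k q N (≰⇒> q≰k))))
      where
      tooBig : ∀ t → ⟦ Q t ∧ (q + q + τ t ≡ᵇ k + k) ⟧ ≡ 0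
      tooBig t rewrite ≡ᵇ-≢ (>⇒≢ (<-≤-trans (+-mono-< (≰⇒> q≰k) (≰⇒> q≰k)) (m≤m+n (q + q) (τ t))))
                     | ∧-zeroʳ (Q t) = refl
    pairsWith : ∀ s → sumSubsets b (λ t → ⟦ P s ∧ Q t ∧ (σ s + τ t ≡ᵇ k + k) ⟧)
                      ≡ sumUpToℕ k (λ i → ⟦ P s ∧ (σ s ≡ᵇ i + i) ⟧ * N i)
    pairsWith s with P s in Ps
    ... | false = trans (sumSubsets-0 b) (sym (sumUpToℕ-0 k))
    ... | true with even s (subst T (sym Ps) tt)
    ...   | q , σs≡ rewrite σs≡ = pairsWithHalf q

+[m+n]-+m≡+n : ∀ m n → + (m + n) - + m ≡ + n
+[m+n]-+m≡+n m n = trans (cong (_- + m) (pos-+ m n)) (cancel (+ m) (+ n))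
  where
  cancel : ∀ x y → (x +ℤ y) - x ≡ y
  cancel = ℤ-Solver.solve-∀

matchableWith : Adj (suc n) → Fin (suc n) → Bool → Subset n → Bool
matchableWith G u b s = perfectlyMatchable G (insertAt s u b)

pmCount : Adj (suc n) → Fin (suc n) → Bool → ℕ → ℕ
pmCount {n} G u b = gradedCount n (matchableWith G u b) (λ s → ⟦ b ⟧ + size s)

module _ (G : Adj (suc n)) (u : Fin (suc n)) where

  matchableWith-even : ∀ b s → T (matchableWith G u b s) → Even (⟦ b ⟧ + size s)
  matchableWith-even b s matchable = subst Even (size-insertAt s u b)
    (matchable⇒even (insertAt s u b) (Equivalence.to (perfectlyMatchable⇔ G (insertAt s u b)) matchable))

  matchableWith-exclusive : ∀ s → ¬ (T (matchableWith G u true s) × T (matchableWith G u false s))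
  matchableWith-exclusive s (with-u , without-u) =
    ¬Even-suc (matchableWith-even false s without-u) (matchableWith-even true s with-u)

  p≡pmCount : ∀ i → p G i ≡ + (pmCount G u true i + pmCount G u false i)
  p≡pmCount i = cong +_ (begin
    length (filterᵇ counted (allSubsets (suc n)))
      ≡⟨ countSubsets (suc n) counted ⟩
    sumSubsets (suc n) (⟦_⟧ ∘ counted)
      ≡⟨ sumSubsets-insertAt n u (⟦_⟧ ∘ counted) ⟩
    sumSubsets n (⟦_⟧ ∘ counted ∘ ins true) + sumSubsets n (⟦_⟧ ∘ counted ∘ ins false)
      ≡⟨ cong₂ _+_ (sizes true) (sizes false) ⟩
    pmCount G u true i + pmCount G u false i ∎)
    where
    open ≡-Reasoning
    counted : Subset (suc n) → Bool
    counted S = perfectlyMatchable G S ∧ (size S ≡ᵇ i + i)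
    ins : Bool → Subset n → Subset (suc n)
    ins b s = insertAt s u b
    sizes : ∀ b → sumSubsets n (⟦_⟧ ∘ counted ∘ ins b) ≡ pmCount G u b i
    sizes b = sumSubsets-cong n λ s → cong (λ z → ⟦ matchableWith G u b s ∧ (z ≡ᵇ i + i) ⟧) (size-insertAt s u b)

  pv≡pmCount : ∀ i → pv G u i ≡ + pmCount G u true i
  pv≡pmCount i = begin
    p G i - p (deleteVertex G u) i                             ≡⟨ cong₂ _-_ (p≡pmCount i) p-deleteVertex ⟩
    + (pmCount G u true i + pmCount G u false i) - + pmCount G u false i
      ≡⟨ cong (λ z → + z - + pmCount G u false i) (+-comm (pmCount G u true i) _) ⟩
    + (pmCount G u false i + pmCount G u true i) - + pmCount G u false i
      ≡⟨ +[m+n]-+m≡+n (pmCount G u false i) _ ⟩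
    + pmCount G u true i                                       ∎
    where
    open ≡-Reasoning
    p-deleteVertex : p (deleteVertex G u) i ≡ + pmCount G u false i
    p-deleteVertex = cong +_ (trans (countSubsets n _) (sumSubsets-cong n λ s →
      cong (λ b → ⟦ b ∧ (size s ≡ᵇ i + i) ⟧) (perfectlyMatchable-deleteVertex G u s)))

⟦∨⟧-disjoint : ∀ x y x′ y′ e → ¬ (T x × T x′) →
  ⟦ ((x ∧ y) ∨ (x′ ∧ y′)) ∧ e ⟧ ≡ ⟦ x ∧ y ∧ e ⟧ + ⟦ x′ ∧ y′ ∧ e ⟧
⟦∨⟧-disjoint true  y true  y′ e both = contradiction (tt , tt) both
⟦∨⟧-disjoint true  y false y′ e _    rewrite ∨-identityʳ y = sym (+-identityʳ _)
⟦∨⟧-disjoint false y x′    y′ e _    = cong ⟦_⟧ (∧-assoc x′ y′ e)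

module _ {n m : ℕ} (G : Adj (suc n)) (u : Fin (suc n)) (H : Adj (suc m)) (w : Fin (suc m)) where

  open Gluing G u H w

  perfectlyMatchable-glue : ∀ (s : Subset n) (t : Subset m) b → perfectlyMatchable G′ (insertAt s u b ++ t) ≡
    (matchableWith G u b s ∧ matchableWith H w false t) ∨ (matchableWith G u false s ∧ matchableWith H w b t)
  perfectlyMatchable-glue s t b = T-⇔⇒≡ (
    ⇔-trans (perfectlyMatchable⇔ G′ (insertAt s u b ++ t)) (
    ⇔-trans (matchable-glue S) (
    ⇔-trans ((asPM G (insertAt s u b) S∘ιG≗ ×-⇔ asPM H (insertAt t w false) S∘ιH∖w≗)
              ⊎-⇔ (asPM G (insertAt s u false) S∘ιG∖u≗ ×-⇔ asPM H (insertAt t w b) S∘ιH≗))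
            (⇔-sym (⇔-trans T-∨ (T-∧ ⊎-⇔ T-∧))))))
    where
    S : Fin (suc n + m) → Bool
    S = lookup (insertAt s u b ++ t)
    asPM : ∀ {k} (adj : Adj k) {S′} (s′ : Subset k) → S′ ≗ lookup s′ → Matchable adj S′ ⇔ T (perfectlyMatchable adj s′)
    asPM adj s′ S′≗ = ⇔-trans (Matchable-≗ S′≗) (⇔-sym (perfectlyMatchable⇔ adj s′))
    S∘ιG≗ : S ∘ ιG ≗ lookup (insertAt s u b)
    S∘ιG≗ = lookup-++ˡ (insertAt s u b) t
    S∘ιH≗ : S ∘ ιH ≗ lookup (insertAt t w b)
    S∘ιH≗ y with punched? w y
    ... | hole      rewrite ιH-hole | insertAt-lookup t w b = trans (S∘ιG≗ u) (insertAt-lookup s u b)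
    ... | punched j rewrite ιH-punched j | insertAt-punchIn t w b j = lookup-++ʳ (insertAt s u b) t j
    ∖-hole : ∀ {k} (r : Subset k) v c → lookup (insertAt r v c) ∖ (_== v) ≗ lookup (insertAt r v false)
    ∖-hole r v c y with punched? v y
    ... | hole      rewrite dec-true (v ≟ v) refl | insertAt-lookup r v false = ∧-zeroʳ _
    ... | punched j rewrite dec-false (punchIn v j ≟ v) (punchInᵢ≢i v j)
                          | insertAt-punchIn r v c j | insertAt-punchIn r v false j = ∧-identityʳ _
    S∘ιG∖u≗ : (S ∘ ιG) ∖ (_== u) ≗ lookup (insertAt s u false)
    S∘ιG∖u≗ a = trans (cong (_∧ not (a == u)) (S∘ιG≗ a)) (∖-hole s u b a)
    S∘ιH∖w≗ : (S ∘ ιH) ∖ (_== w) ≗ lookup (insertAt t w false)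
    S∘ιH∖w≗ y = trans (cong (_∧ not (y == w)) (S∘ιH≗ y)) (∖-hole t w b y)

  p-glue : ∀ k → p G′ k ≡ + ((pmCount G u true ⋆ pmCount H w false) k
                             + (pmCount G u false ⋆ pmCount H w true) k
                             + (pmCount G u false ⋆ pmCount H w false) k)
  p-glue k = cong +_ (begin
    length (filterᵇ counted (allSubsets (suc n + m)))
      ≡⟨ countSubsets (suc n + m) counted ⟩
    sumSubsets (suc n + m) (⟦_⟧ ∘ counted)
      ≡⟨ sumSubsets-++ (suc n) m (⟦_⟧ ∘ counted) ⟩
    sumSubsets (suc n) (λ s → sumSubsets m (λ t → ⟦ counted (s ++ t) ⟧))
      ≡⟨ sumSubsets-insertAt n u (λ s → sumSubsets m (λ t → ⟦ counted (s ++ t) ⟧)) ⟩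
    sumSubsets n (λ s → sumSubsets m (λ t → ⟦ counted (insertAt s u true ++ t) ⟧))
      + sumSubsets n (λ s → sumSubsets m (λ t → ⟦ counted (insertAt s u false ++ t) ⟧))
      ≡⟨ cong₂ _+_ (trans (sumSubsets-cong n (λ s → trans (sumSubsets-cong m (with-u s)) (sumSubsets-+ m _ _)))
                          (sumSubsets-+ n _ _))
                   (sumSubsets-cong n λ s → sumSubsets-cong m (without-u s)) ⟩
    (pairs true false + pairs false true) + pairs false false
      ≡⟨ cong₂ _+_ (cong₂ _+_ (convolve true false) (convolve false true)) (convolve false false) ⟩
    (pmCount G u true ⋆ pmCount H w false) k + (pmCount G u false ⋆ pmCount H w true) k
      + (pmCount G u false ⋆ pmCount H w false) k ∎)
    where
    open ≡-Reasoning
    counted : Subset (suc n + m) → Bool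
    counted S = perfectlyMatchable G′ S ∧ (size S ≡ᵇ k + k)
    pair : Bool → Bool → Subset n → Subset m → ℕ
    pair b b′ s t = ⟦ matchableWith G u b s ∧ matchableWith H w b′ t ∧ ((⟦ b ⟧ + size s) + (⟦ b′ ⟧ + size t) ≡ᵇ k + k) ⟧
    pairs : Bool → Bool → ℕ
    pairs b b′ = sumSubsets n (λ s → sumSubsets m (pair b b′ s))
    convolve : ∀ b b′ → pairs b b′ ≡ (pmCount G u b ⋆ pmCount H w b′) k
    convolve b b′ = sumSubsets²≡⋆ (matchableWith G u b) (λ s → ⟦ b ⟧ + size s)
                                  (matchableWith H w b′) (λ t → ⟦ b′ ⟧ + size t)
                                  (matchableWith-even G u b) k
    size-glued : ∀ s t b → size (insertAt s u b ++ t) ≡ (⟦ b ⟧ + size s) + size t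
    size-glued s t b = trans (size-++ (insertAt s u b) t) (cong (_+ size t) (size-insertAt s u b))
    with-u : ∀ s t → ⟦ counted (insertAt s u true ++ t) ⟧ ≡ pair true false s t + pair false true s t
    with-u s t rewrite perfectlyMatchable-glue s t true | size-glued s t true =
      trans (⟦∨⟧-disjoint _ _ _ _ _ (matchableWith-exclusive G u s))
            (cong (λ z → pair true false s t + ⟦ matchableWith G u false s ∧ matchableWith H w true t ∧ (z ≡ᵇ k + k) ⟧)
                  (sym (+-suc (size s) (size t))))
    without-u : ∀ s t → ⟦ counted (insertAt s u false ++ t) ⟧ ≡ pair false false s t
    without-u s t rewrite perfectlyMatchable-glue s t false | size-glued s t false
                        | ∨-idem (matchableWith G u false s ∧ matchableWith H w false t) =
      cong ⟦_⟧ (∧-assoc (matchableWith G u false s) _ _)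

mainTheorem6 : (n m : ℕ) (G : Adj (suc n)) (u : Fin (suc n)) (H : Adj (suc m)) (w : Fin (suc m))
    → IsSimple G → IsSimple H
    → ∀ k → p (glue G u H w) k ≡ ((p G *ₚ p H) -ₚ (pv G u *ₚ pv H w)) k
mainTheorem6 n m G u H w _ _ k = begin
  p (glue G u H w) k                     ≡⟨ p-glue G u H w k ⟩
  + (cb + ad + ab)                       ≡⟨ sym (+[m+n]-+m≡+n cd _) ⟩
  + (cd + (cb + ad + ab)) - + cd         ≡⟨ cong₂ _-_ (sym p*p) (sym (*ₚ-pos (pv≡pmCount G u) (pv≡pmCount H w) k)) ⟩
  ((p G *ₚ p H) -ₚ (pv G u *ₚ pv H w)) k ∎
  where
  open ≡-Reasoning
  C = pmCount G u true
  A = pmCount G u false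
  D = pmCount H w true
  B = pmCount H w false
  cb = (C ⋆ B) k
  ad = (A ⋆ D) k
  ab = (A ⋆ B) k
  cd = (C ⋆ D) k
  p*p : (p G *ₚ p H) k ≡ + (cd + (cb + ad + ab))
  p*p = trans (*ₚ-pos (p≡pmCount G u) (p≡pmCount H w) k) (cong +_ (⋆-expand C A D B k))
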